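{- Let $i\ge 7$. The only net occurrence in $F_i$ that is an occurrence of $F_{i-2}$ is the one starting at position $f_{i-1}+1$, and the only net occurrences in $F_i$ that are occurrences of $F_{i-2}\,Q_i$ are the two starting at positions $1$ and $f_{i-2}+1$ (and these three occurrences are indeed net occurrences).
   Context: Fibonacci words: $F_1=\texttt{b}$, $F_2=\texttt{a}$, $F_k=F_{k-1}F_{k-2}$ for $k\ge 3$; $f_k=|F_k|$. For $i\ge 7$, $Q_i:=F_{i-5}F_{i-6}\cdots F_3F_2$. Positions are 1-indexed; $T[i\ldots j]$ is a substring. In a text $T$ of length $n$, an occurrence is a pair $(i,j)$, an occurrence of $S$ if $T[i\ldots j]=S$. A string is unique in $T$ if it occurs exactly once and repeated if it occurs at least twice. $(i,j)$ is a net occurrence if $T[i\ldots j]$ is repeated while $T[i-1\ldots j]$ and $T[i\ldots j+1]$ are unique (with $T[i-1\ldots j]$ regarded unique when $i=1$ and $T[i\ldots j+1]$ regarded unique when $j=n$). -}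

module Defs where

open import Data.Nat using (ℕ; zero; suc; _+_; _∸_; _≤_)
open import Data.List using (List; []; _∷_; _++_; take; drop; length)
open import Data.Product using (Σ; ∃; _×_; _,_)
open import Data.Sum using (_⊎_)
open import Relation.Binary.PropositionalEquality using (_≡_; _≢_)

data Letter : Set where
  a b : Letter

Word : Set
Word = List Letter

-- Fibonacci words: F 1 = b, F 2 = a, F (k) = F (k-1) F (k-2) for k ≥ 3.
-- (F 0 is an unused junk value.)
F : ℕ → Word
F zero = []
F (suc zero) = b ∷ []
F (suc (suc zero)) = a ∷ []
F (suc (suc (suc k))) = F (suc (suc k)) ++ F (suc k)

f : ℕ → ℕ
f k = length (F k)

QQ : ℕ → Word
QQ zero = []
QQ (suc zero) = []
QQ (suc (suc k)) = F (suc (suc k)) ++ QQ (suc k)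

Q : ℕ → Word
Q i = QQ (i ∸ 5)

-- the substring T[i … j] (1-indexed, inclusive)
sub : Word → ℕ → ℕ → Word
sub T i j = take (suc j ∸ i) (drop (i ∸ 1) T)

-- S occurs in T starting at (1-indexed) position p, i.e. (p, p+|S|-1) is an occurrence of S
OccursAt : Word → Word → ℕ → Set
OccursAt T S p = (1 ≤ p) × (take (length S) (drop (p ∸ 1) T) ≡ S)

Unique : Word → Word → Set
Unique T S = Σ ℕ λ p → OccursAt T S p × (∀ q → OccursAt T S q → q ≡ p)

Repeated : Word → Word → Set
Repeated T S = Σ ℕ λ p → Σ ℕ λ q → p ≢ q × OccursAt T S p × OccursAt T S q

NetOcc : Word → ℕ → ℕ → Set
NetOcc T i j =
  (1 ≤ i) × (i ≤ j) × (j ≤ length T)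
  × Repeated T (sub T i j)
  × ((i ≡ 1) ⊎ Unique T (sub T (i ∸ 1) j))
  × ((j ≡ length T) ⊎ Unique T (sub T i (suc j)))

{-# OPTIONS --safe #-}
module Submission where

-- F i = F (i-2) F (i-3) F (i-2), and F (i-2) occurs in F i only at offsets 0, f (i-2) and f (i-1):
-- F k = φ (F (k-1)) for the morphism φ : a ↦ ab, b ↦ a, and occurrences in φ w pull back to
-- occurrences in w.  Moreover F (i-1) = P x y and F (i-3) F (i-2) = P y x for P = F (i-2) Q i and
-- letters x ≢ y, so F i = P x y F (i-2) = F (i-2) P y x.  The occurrences of F (i-2) at 0 and f (i-2)
-- are both followed by a, so F (i-2) a is repeated; the suffix occurrence is preceded by y where the
-- one at f (i-2) is preceded by x.  P occurs only at 0 and f (i-2), and these two occurrences are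
-- told apart by their neighbouring letters x and y.

open import Defs
open import Data.Nat using (ℕ; zero; suc; _+_; _∸_; _≤_; z≤n; s≤s)
open import Data.Nat.Properties
  using (+-comm; +-assoc; +-identityʳ; +-cancelˡ-≡; +-monoʳ-≤; m≤m+n; m≤n+m; ≤-trans; ≤-reflexive;
         <⇒≤; <-≤-trans; m≤n⇒m⊓n≡m; ∸-monoˡ-≤; m+[n∸m]≡n; m+n∸m≡n; m+n∸n≡m; m+1+n≢m)
open import Data.List using (List; []; _∷_; _++_; take; drop; length; [_])
open import Data.List.Properties
  using (++-assoc; ++-identityʳ; ++-identityʳ-unique; ++-cancelˡ; ++-conicalˡ; ++-conicalʳ;
         length-++; length-take; length-drop; take++drop≡id;
         ∷-injectiveˡ; ∷-injectiveʳ; ∷ʳ-injectiveˡ; ∷ʳ-injectiveʳ)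
open import Data.Product using (∃-syntax; ∃₂; _×_; _,_; proj₁; proj₂)
open import Data.Sum using (_⊎_; inj₁; inj₂)
import Data.Sum as Sum
open import Data.Empty using (⊥-elim)
open import Function using (_∘_)
open import Relation.Nullary using (¬_)
open import Relation.Binary.PropositionalEquality hiding ([_])
open ≡-Reasoning

module _ {E : Set} where

  take-drop-++ : ∀ (X W Y : List E) → take (length W) (drop (length X) (X ++ W ++ Y)) ≡ W
  take-drop-++ (_ ∷ X) W Y = take-drop-++ X W Y
  take-drop-++ [] [] Y = refl
  take-drop-++ [] (w ∷ W) Y = cong (w ∷_) (take-drop-++ [] W Y)

  take-drop⇒++ : ∀ n (T W : List E) → W ≢ [] → take (length W) (drop n T) ≡ W →
    ∃₂ λ X Y → T ≡ X ++ W ++ Y × length X ≡ n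
  take-drop⇒++ zero T W _ e =
    [] , drop (length W) T ,
    trans (sym (take++drop≡id (length W) T)) (cong (_++ drop (length W) T) e) , refl
  take-drop⇒++ (suc n) [] [] W≢[] _ = ⊥-elim (W≢[] refl)
  take-drop⇒++ (suc n) (t ∷ T) W W≢[] e with take-drop⇒++ n T W W≢[] e
  ... | X , Y , refl , refl = t ∷ X , Y , refl , refl

  length-++-++ : ∀ (X W Y : List E) → length (X ++ W ++ Y) ≡ length X + (length W + length Y)
  length-++-++ X W Y = trans (length-++ X) (cong (length X +_) (length-++ W))

  suc-+-length-∷ʳ : ∀ n (W : List E) l → suc (n + length W) ≡ n + length (W ++ [ l ])
  suc-+-length-∷ʳ n W l = sym (begin
    n + length (W ++ [ l ]) ≡⟨ cong (n +_) (length-++ W) ⟩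
    n + (length W + 1)      ≡⟨ sym (+-assoc n (length W) 1) ⟩
    n + length W + 1        ≡⟨ +-comm _ 1 ⟩
    suc (n + length W)      ∎)

  extendʳ : ∀ {T : List E} X W {Y l Y′} → T ≡ X ++ W ++ Y → Y ≡ l ∷ Y′ →
    T ≡ X ++ (W ++ [ l ]) ++ Y′
  extendʳ X W T≡ refl = trans T≡ (cong (X ++_) (sym (++-assoc W _ _)))

  shrinkʳ : ∀ {T : List E} X W {l Y} → T ≡ X ++ (W ++ [ l ]) ++ Y → T ≡ X ++ W ++ l ∷ Y
  shrinkʳ X W T≡ = trans T≡ (cong (X ++_) (++-assoc W _ _))

  ∷ʳ≢[] : ∀ (X : List E) l → X ++ [ l ] ≢ []
  ∷ʳ≢[] X l e with ++-conicalʳ X [ l ] e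
  ... | ()

occursAt-++ : ∀ {T} X W Y → T ≡ X ++ W ++ Y → OccursAt T W (suc (length X))
occursAt-++ X W Y refl = s≤s z≤n , take-drop-++ X W Y

occursAt⇒++ : ∀ {T W} p → W ≢ [] → OccursAt T W p →
  ∃₂ λ X Y → T ≡ X ++ W ++ Y × p ≡ suc (length X)
occursAt⇒++ {T} {W} (suc p) W≢[] (_ , e) with take-drop⇒++ p T W W≢[] e
... | X , Y , T≡ , refl = X , Y , T≡ , refl

++⇒sub : ∀ {T} X W Y {p q} → T ≡ X ++ W ++ Y → p ≡ length X + 1 → q ≡ length X + length W →
  sub T p q ≡ W
++⇒sub X W Y refl refl refl rewrite +-comm (length X) 1 =
  trans (cong (λ n → take n (drop (length X) (X ++ W ++ Y))) (m+n∸m≡n (length X) (length W)))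
        (take-drop-++ X W Y)

sub⇒++ : ∀ {T S p q} → 1 ≤ p → p ≤ q → q ≤ length T → sub T p q ≡ S →
  ∃₂ λ X Y → T ≡ X ++ S ++ Y × p ≡ length X + 1 × q ≡ length X + length S
sub⇒++ {T} {p = suc p} {q} (s≤s z≤n) p<q q≤∣T∣ refl =
  take p T , drop (q ∸ p) (drop p T) , T≡ , sym (trans (cong (_+ 1) ∣X∣≡p) (+-comm p 1)) ,
  trans (sym (m+[n∸m]≡n (<⇒≤ p<q))) (sym (cong₂ _+_ ∣X∣≡p ∣S∣≡q∸p))
  where
  T≡ : T ≡ take p T ++ take (q ∸ p) (drop p T) ++ drop (q ∸ p) (drop p T)
  T≡ = sym (trans (cong (take p T ++_) (take++drop≡id (q ∸ p) (drop p T))) (take++drop≡id p T))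
  ∣X∣≡p : length (take p T) ≡ p
  ∣X∣≡p = trans (length-take p T) (m≤n⇒m⊓n≡m (<⇒≤ (<-≤-trans p<q q≤∣T∣)))
  ∣S∣≡q∸p : length (take (q ∸ p) (drop p T)) ≡ q ∸ p
  ∣S∣≡q∸p = trans (length-take (q ∸ p) (drop p T))
    (m≤n⇒m⊓n≡m (≤-trans (∸-monoˡ-≤ p q≤∣T∣) (≤-reflexive (sym (length-drop p T)))))

unique-intro : ∀ {T W} X Y → W ≢ [] → T ≡ X ++ W ++ Y →
  (∀ X′ Y′ → T ≡ X′ ++ W ++ Y′ → X′ ≡ X) → Unique T W
unique-intro X Y W≢[] T≡ only = suc (length X) , occursAt-++ X _ Y T≡ , at-X
  where
  at-X : ∀ q → OccursAt _ _ q → q ≡ suc (length X)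
  at-X q occ with occursAt⇒++ q W≢[] occ
  ... | X′ , Y′ , T≡′ , refl = cong (suc ∘ length) (only X′ Y′ T≡′)

repeated-intro : ∀ {T W} Y₁ X Y₂ → X ≢ [] → T ≡ W ++ Y₁ → T ≡ X ++ W ++ Y₂ → Repeated T W
repeated-intro Y₁ [] Y₂ X≢[] _ _ = ⊥-elim (X≢[] refl)
repeated-intro Y₁ X@(_ ∷ _) Y₂ _ T≡₁ T≡₂ =
  1 , suc (length X) , (λ ()) , occursAt-++ [] _ Y₁ T≡₁ , occursAt-++ X _ Y₂ T≡₂

repeated⇒¬unique : ∀ {T W} → Repeated T W → ¬ Unique T W
repeated⇒¬unique (p , q , p≢q , occ-p , occ-q) (_ , _ , only) =
  p≢q (trans (only p occ-p) (sym (only q occ-q)))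

LeftMaximal : Word → Word → Word → Set
LeftMaximal T X W = X ≡ [] ⊎ ∃₂ λ X′ l → X ≡ X′ ++ [ l ] × Unique T (l ∷ W)

RightMaximal : Word → Word → Word → Set
RightMaximal T W Y = Y ≡ [] ⊎ ∃₂ λ l Y′ → Y ≡ l ∷ Y′ × Unique T (W ++ [ l ])

netOcc-intro : ∀ {T} X W Y → T ≡ X ++ W ++ Y → W ≢ [] → Repeated T W →
  LeftMaximal T X W → RightMaximal T W Y → NetOcc T (length X + 1) (length X + length W)
netOcc-intro X [] Y _ W≢[] = ⊥-elim (W≢[] refl)
netOcc-intro {T} X W@(_ ∷ _) Y T≡ _ repeated left right =
  m≤n+m 1 (length X) , +-monoʳ-≤ (length X) (s≤s z≤n) , inside ,
  subst (Repeated T) (sym (++⇒sub X W Y T≡ refl refl)) repeated ,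
  leftCondition left , rightCondition right
  where
  ∣T∣≡ : length T ≡ length X + (length W + length Y)
  ∣T∣≡ = trans (cong length T≡) (length-++-++ X W Y)
  inside : length X + length W ≤ length T
  inside = ≤-trans (+-monoʳ-≤ (length X) (m≤m+n (length W) (length Y))) (≤-reflexive (sym ∣T∣≡))
  leftCondition : LeftMaximal T X W →
    (length X + 1 ≡ 1) ⊎ Unique T (sub T (length X + 1 ∸ 1) (length X + length W))
  leftCondition (inj₁ refl) = inj₁ refl
  leftCondition (inj₂ (X′ , l , refl , unique)) =
    inj₂ (subst (Unique T) (sym (++⇒sub X′ (l ∷ W) Y (trans T≡ (++-assoc X′ [ l ] (W ++ Y))) p≡ q≡))
                unique)
    where
    p≡ : length (X′ ++ [ l ]) + 1 ∸ 1 ≡ length X′ + 1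
    p≡ = trans (m+n∸n≡m _ 1) (length-++ X′)
    q≡ : length (X′ ++ [ l ]) + length W ≡ length X′ + length (l ∷ W)
    q≡ = trans (cong (_+ length W) (length-++ X′)) (+-assoc (length X′) 1 (length W))
  rightCondition : RightMaximal T W Y →
    (length X + length W ≡ length T) ⊎ Unique T (sub T (length X + 1) (suc (length X + length W)))
  rightCondition (inj₁ refl) = inj₁ (sym (trans ∣T∣≡ (cong (length X +_) (+-identityʳ (length W)))))
  rightCondition (inj₂ (l , Y′ , refl , unique)) =
    inj₂ (subst (Unique T) (sym (++⇒sub X (W ++ [ l ]) Y′ (extendʳ X W T≡ refl) refl
                                   (suc-+-length-∷ʳ (length X) W l))) unique)

netOcc⇒++ : ∀ {T S p q} → NetOcc T p q → sub T p q ≡ S →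
  ∃₂ λ X Y → T ≡ X ++ S ++ Y × p ≡ length X + 1 × RightMaximal T S Y
netOcc⇒++ {T} {S} {p} {q} (1≤p , p≤q , q≤∣T∣ , _ , _ , right) sub≡S
  with sub⇒++ 1≤p p≤q q≤∣T∣ sub≡S
... | X , Y , T≡ , p≡ , q≡ = X , Y , T≡ , p≡ , rightMaximal Y T≡ right
  where
  rightMaximal : ∀ Y′ → T ≡ X ++ S ++ Y′ → (q ≡ length T) ⊎ Unique T (sub T p (suc q)) →
    RightMaximal T S Y′
  rightMaximal [] _ _ = inj₁ refl
  rightMaximal (l ∷ Y′) T≡′ (inj₁ q≡∣T∣) =
    ⊥-elim (m+1+n≢m (length S) (sym (+-cancelˡ-≡ (length X) _ _
      (trans (sym q≡) (trans q≡∣T∣ (trans (cong length T≡′) (length-++-++ X S (l ∷ Y′))))))))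
  rightMaximal (l ∷ Y′) T≡′ (inj₂ unique) =
    inj₂ (l , Y′ , refl ,
          subst (Unique T) (++⇒sub X (S ++ [ l ]) Y′ (extendʳ X S T≡′ refl) p≡
                                   (trans (cong suc q≡) (suc-+-length-∷ʳ (length X) S l))) unique)

φ : Word → Word
φ [] = []
φ (a ∷ w) = a ∷ b ∷ φ w
φ (b ∷ w) = a ∷ φ w

φ-++ : ∀ u v → φ (u ++ v) ≡ φ u ++ φ v
φ-++ [] v = refl
φ-++ (a ∷ u) v = cong (λ w → a ∷ b ∷ w) (φ-++ u v)
φ-++ (b ∷ u) v = cong (a ∷_) (φ-++ u v)

φ-F : ∀ k → φ (F (1 + k)) ≡ F (2 + k)
φ-F zero = refl
φ-F (suc zero) = refl
φ-F (suc (suc k)) = trans (φ-++ (F (2 + k)) (F (1 + k))) (cong₂ _++_ (φ-F (suc k)) (φ-F k))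

φ≢b∷ : ∀ w {R} → φ w ≢ b ∷ R
φ≢b∷ [] ()
φ≢b∷ (a ∷ w) ()
φ≢b∷ (b ∷ w) ()

φ-++-a∷ : ∀ v R → ∃[ R′ ] φ v ++ a ∷ R ≡ a ∷ R′
φ-++-a∷ [] R = R , refl
φ-++-a∷ (a ∷ v) R = _ , refl
φ-++-a∷ (b ∷ v) R = _ , refl

φ-split : ∀ w X Z → φ w ≡ X ++ a ∷ Z → ∃₂ λ x z → w ≡ x ++ z × φ x ≡ X × φ z ≡ a ∷ Z
φ-split w [] Z e = [] , w , refl , refl , e
φ-split (a ∷ w) (a ∷ b ∷ X) Z e with φ-split w X Z (∷-injectiveʳ (∷-injectiveʳ e))
... | x , z , refl , refl , φz≡ = a ∷ x , z , refl , refl , φz≡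
φ-split (b ∷ w) (a ∷ X) Z e with φ-split w X Z (∷-injectiveʳ e)
... | x , z , refl , refl , φz≡ = b ∷ x , z , refl , refl , φz≡
φ-split [] (_ ∷ _) Z ()
φ-split (a ∷ w) (a ∷ []) Z ()
φ-split (a ∷ w) (a ∷ a ∷ X) Z ()
φ-split (a ∷ w) (b ∷ X) Z ()
φ-split (b ∷ w) (b ∷ X) Z ()

φ-cancelˡ : ∀ v z R → φ z ≡ φ v ++ a ∷ R → ∃[ y ] z ≡ v ++ y × φ y ≡ a ∷ R
φ-cancelˡ [] z R e = z , refl , e
φ-cancelˡ (a ∷ v) (a ∷ z) R e with φ-cancelˡ v z R (∷-injectiveʳ (∷-injectiveʳ e))
... | y , refl , φy≡ = y , refl , φy≡
φ-cancelˡ (b ∷ v) (b ∷ z) R e with φ-cancelˡ v z R (∷-injectiveʳ e)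
... | y , refl , φy≡ = y , refl , φy≡
φ-cancelˡ (a ∷ v) (b ∷ z) R e = ⊥-elim (φ≢b∷ z (∷-injectiveʳ e))
φ-cancelˡ (b ∷ v) (a ∷ z) R e with φ-++-a∷ v R
... | R′ , φv++a∷R≡ with trans (∷-injectiveʳ e) φv++a∷R≡
... | ()
φ-cancelˡ (a ∷ _) [] R ()
φ-cancelˡ (b ∷ _) [] R ()

φ-desubstitute : ∀ w X v R → φ w ≡ X ++ φ v ++ a ∷ R →
  ∃₂ λ x y → w ≡ x ++ v ++ y × φ x ≡ X × φ y ≡ a ∷ R
φ-desubstitute w X v R e with φ-++-a∷ v R
... | R′ , φv++a∷R≡ with φ-split w X R′ (trans e (cong (X ++_) φv++a∷R≡))
... | x , z , refl , φx≡X , φz≡ with φ-cancelˡ v z R (trans φz≡ (sym φv++a∷R≡))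
... | y , refl , φy≡ = x , y , refl , φx≡X , φy≡

F-head : ∀ n → ∃[ w ] F (2 + n) ≡ a ∷ w
F-head zero = [] , refl
F-head (suc n) with F-head n
... | w , F≡a∷w = w ++ F (1 + n) , cong (_++ F (1 + n)) F≡a∷w

F≢[] : ∀ n → F (2 + n) ≢ []
F≢[] n F≡[] with F-head n
... | w , F≡a∷w with trans (sym F≡a∷w) F≡[]
... | ()

F-ends : ∀ n → (∃[ H ] F (2 + n) ≡ H ++ [ a ]) ⊎ (∃[ H ] F (2 + n) ≡ H ++ a ∷ b ∷ [])
F-ends zero = inj₁ ([] , refl)
F-ends (suc zero) = inj₂ ([] , refl)
F-ends (suc (suc n)) = Sum.map (prepend (F (3 + n))) (prepend (F (3 + n))) (F-ends n)
  where
  prepend : ∀ U {W S : Word} → ∃[ H ] W ≡ H ++ S → ∃[ H ] U ++ W ≡ H ++ S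
  prepend U (H , W≡H++S) = U ++ H , trans (cong (U ++_) W≡H++S) (sym (++-assoc U H _))

record SwappedEnds (m : ℕ) : Set where
  field
    x y         : Letter
    x≢y         : x ≢ y
    init        : Word
    F≡init++x   : F (2 + m) ≡ init ++ [ x ]
    F++F≡QQ++xy : F (2 + m) ++ F (1 + m) ≡ QQ (1 + m) ++ x ∷ y ∷ []
    F++F≡QQ++yx : F (1 + m) ++ F (2 + m) ≡ QQ (1 + m) ++ y ∷ x ∷ []

swappedEnds : ∀ m → SwappedEnds m
swappedEnds zero = record
  { x = a ; y = b ; x≢y = λ () ; init = [] ; F≡init++x = refl ; F++F≡QQ++xy = refl ; F++F≡QQ++yx = refl }
swappedEnds (suc m) = record
  { x = y ; y = x ; x≢y = x≢y ∘ sym ; init = QQ (1 + m) ++ [ x ]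
  ; F≡init++x = trans F++F≡QQ++xy (sym (++-assoc (QQ (1 + m)) [ x ] [ y ]))
  ; F++F≡QQ++xy = begin
      (F (2 + m) ++ F (1 + m)) ++ F (2 + m)  ≡⟨ ++-assoc (F (2 + m)) _ _ ⟩
      F (2 + m) ++ F (1 + m) ++ F (2 + m)    ≡⟨ cong (F (2 + m) ++_) F++F≡QQ++yx ⟩
      F (2 + m) ++ QQ (1 + m) ++ y ∷ x ∷ []  ≡⟨ sym (++-assoc (F (2 + m)) _ _) ⟩
      QQ (2 + m) ++ y ∷ x ∷ []               ∎
  ; F++F≡QQ++yx = trans (cong (F (2 + m) ++_) F++F≡QQ++xy) (sym (++-assoc (F (2 + m)) _ _))
  }
  where open SwappedEnds (swappedEnds m)

QQ-step : ∀ m → QQ (3 + m) ≡ F (4 + m) ++ QQ (1 + m)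
QQ-step m = sym (++-assoc (F (3 + m)) (F (2 + m)) (QQ (1 + m)))

Cut : ℕ → Word → Set
Cut n X = X ≡ [] ⊎ X ≡ F (2 + n) ⊎ X ≡ F (3 + n)

φ-Cut : ∀ n {x} → Cut n x → Cut (suc n) (φ x)
φ-Cut n (inj₁ refl) = inj₁ refl
φ-Cut n (inj₂ (inj₁ refl)) = inj₂ (inj₁ (φ-F (1 + n)))
φ-Cut n (inj₂ (inj₂ refl)) = inj₂ (inj₂ (φ-F (2 + n)))

-- The last letter of F (2 + n) is left free because pulling an occurrence back along φ only
-- recovers it up to its last letter.
init-F-occurrences : ∀ n {G l₀} → F (2 + n) ≡ G ++ [ l₀ ] →
  ∀ X l Y → F (4 + n) ≡ X ++ G ++ l ∷ Y → Cut n X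
init-F-occurrences zero {[]} refl [] l Y _ = inj₁ refl
init-F-occurrences zero {[]} refl (a ∷ []) l Y _ = inj₂ (inj₁ refl)
init-F-occurrences zero {[]} refl (a ∷ b ∷ []) l Y _ = inj₂ (inj₂ refl)
init-F-occurrences zero {[]} refl (a ∷ b ∷ a ∷ []) l Y ()
init-F-occurrences zero {[]} refl (a ∷ b ∷ a ∷ _ ∷ _) l Y ()
init-F-occurrences zero {[]} refl (a ∷ b ∷ b ∷ _) l Y ()
init-F-occurrences zero {[]} refl (a ∷ a ∷ _) l Y ()
init-F-occurrences zero {[]} refl (b ∷ _) l Y ()
init-F-occurrences zero {_ ∷ []} ()
init-F-occurrences zero {_ ∷ _ ∷ _} ()
init-F-occurrences (suc n) {G} {l₀} F≡G++l₀ X l Y F≡X++G++lY = by-ending (F-ends n)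
  where
  φF≡ : ∀ H S S′ {s} → F (2 + n) ≡ H ++ S → φ S ≡ S′ ++ [ s ] →
    φ (F (4 + n)) ≡ X ++ φ H ++ S′ ++ l ∷ Y
  φF≡ H S S′ {s} F≡H++S φS≡ = begin
    φ (F (4 + n))              ≡⟨ φ-F (3 + n) ⟩
    F (5 + n)                  ≡⟨ F≡X++G++lY ⟩
    X ++ G ++ l ∷ Y            ≡⟨ cong (λ G → X ++ G ++ l ∷ Y) G≡ ⟩
    X ++ (φ H ++ S′) ++ l ∷ Y  ≡⟨ cong (X ++_) (++-assoc (φ H) S′ (l ∷ Y)) ⟩
    X ++ φ H ++ S′ ++ l ∷ Y    ∎
    where
    G≡ : G ≡ φ H ++ S′
    G≡ = ∷ʳ-injectiveˡ G (φ H ++ S′) (begin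
      G ++ [ l₀ ]           ≡⟨ sym F≡G++l₀ ⟩
      F (3 + n)             ≡⟨ sym (φ-F (1 + n)) ⟩
      φ (F (2 + n))         ≡⟨ cong φ F≡H++S ⟩
      φ (H ++ S)            ≡⟨ φ-++ H S ⟩
      φ H ++ φ S            ≡⟨ cong (φ H ++_) φS≡ ⟩
      φ H ++ S′ ++ [ s ]    ≡⟨ sym (++-assoc (φ H) S′ [ s ]) ⟩
      (φ H ++ S′) ++ [ s ]  ∎)

  by-ending : (∃[ H ] F (2 + n) ≡ H ++ [ a ]) ⊎ (∃[ H ] F (2 + n) ≡ H ++ a ∷ b ∷ []) → Cut (suc n) X
  by-ending (inj₁ (H , F≡H++a))
    with φ-desubstitute (F (4 + n)) X H (l ∷ Y) (φF≡ H [ a ] [ a ] F≡H++a refl)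
  ... | x , l′ ∷ y , F≡x++H++l′y , φx≡X , _ =
    subst (Cut (suc n)) φx≡X (φ-Cut n (init-F-occurrences n F≡H++a x l′ y F≡x++H++l′y))
  by-ending (inj₂ (H , F≡H++ab))
    with φ-desubstitute (F (4 + n)) X H (b ∷ l ∷ Y) (φF≡ H (a ∷ b ∷ []) (a ∷ b ∷ []) F≡H++ab refl)
  ... | x , [] , _ , _ , ()
  ... | x , a ∷ [] , _ , _ , ()
  ... | x , b ∷ y , _ , _ , φy≡ = ⊥-elim (φ≢b∷ y (∷-injectiveʳ φy≡))
  ... | x , a ∷ l′ ∷ y , F≡x++H++al′y , φx≡X , _ =
    subst (Cut (suc n)) φx≡X (φ-Cut n (init-F-occurrences n (trans F≡H++ab (sym (++-assoc H [ a ] [ b ])))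
                                         x l′ y (extendʳ x H F≡x++H++al′y refl)))

F-occurrences : ∀ n X Y → F (4 + n) ≡ X ++ F (2 + n) ++ Y → Cut n X
F-occurrences n X Y F≡X++F++Y =
  init-F-occurrences n F≡init++x X x Y
    (trans F≡X++F++Y (cong (X ++_) (trans (cong (_++ Y) F≡init++x) (++-assoc init [ x ] Y))))
  where open SwappedEnds (swappedEnds n)

-- With i = 7 + k: A, B, C, T are F (i-2), F (i-1), F (i-3), F i, and P = F (i-2) Q i.
module NetOccurrences (k : ℕ) where

  A B C T Q′ P : Word
  A = F (5 + k)
  B = F (6 + k)
  C = F (4 + k)
  T = F (7 + k)
  Q′ = QQ (2 + k)
  P = A ++ Q′

  open SwappedEnds (swappedEnds (3 + k))

  B≡P++xy : B ≡ P ++ x ∷ y ∷ []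
  B≡P++xy = trans F++F≡QQ++xy (cong (_++ x ∷ y ∷ []) (QQ-step (1 + k)))

  B≡P++x++y : B ≡ (P ++ [ x ]) ++ [ y ]
  B≡P++x++y = trans B≡P++xy (sym (++-assoc P [ x ] [ y ]))

  T≡B++A : T ≡ B ++ A ++ []
  T≡B++A = cong (B ++_) (sym (++-identityʳ A))

  T≡A++C++A : T ≡ A ++ C ++ A
  T≡A++C++A = ++-assoc A C A

  T≡P++xyA : T ≡ P ++ x ∷ y ∷ A
  T≡P++xyA = trans (cong (_++ A) B≡P++xy) (++-assoc P (x ∷ y ∷ []) A)

  T≡A++P++yx : T ≡ A ++ P ++ y ∷ x ∷ []
  T≡A++P++yx =
    trans T≡A++C++A (cong (A ++_) (trans F++F≡QQ++yx (cong (_++ y ∷ x ∷ []) (QQ-step (1 + k)))))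

  T≡A++A++Q′yx : T ≡ A ++ A ++ Q′ ++ y ∷ x ∷ []
  T≡A++A++Q′yx = trans T≡A++P++yx (cong (A ++_) (++-assoc A Q′ _))

  Q′≡a∷ : ∃[ w ] Q′ ≡ a ∷ w
  Q′≡a∷ with F-head k
  ... | w , F≡a∷w = w ++ QQ (1 + k) , cong (_++ QQ (1 + k)) F≡a∷w

  Q′≢[] : Q′ ≢ []
  Q′≢[] Q′≡[] with Q′≡a∷
  ... | w , Q′≡a∷w with trans (sym Q′≡a∷w) Q′≡[]
  ... | ()

  A-occurrence : ∀ X {Y} → T ≡ X ++ A ++ Y → X ≡ [] ⊎ X ≡ A ⊎ X ≡ B
  A-occurrence X {Y} = F-occurrences (3 + k) X Y

  A-followed-by-a : ∀ {X Y} → X ≡ [] ⊎ X ≡ A → T ≡ X ++ A ++ Y → ∃[ Y′ ] Y ≡ a ∷ Y′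
  A-followed-by-a (inj₁ refl) T≡ with F-head (2 + k)
  ... | w , C≡a∷w =
    w ++ A , trans (++-cancelˡ A _ _ (trans (sym T≡) T≡A++C++A)) (cong (_++ A) C≡a∷w)
  A-followed-by-a (inj₂ refl) T≡ with Q′≡a∷
  ... | w , Q′≡a∷w =
    w ++ y ∷ x ∷ [] ,
    trans (++-cancelˡ A _ _ (++-cancelˡ A _ _ (trans (sym T≡) T≡A++A++Q′yx)))
          (cong (_++ y ∷ x ∷ []) Q′≡a∷w)

  A++a-repeated : Repeated T (A ++ [ a ])
  A++a-repeated
    with A-followed-by-a (inj₁ refl) T≡A++C++A | A-followed-by-a (inj₂ refl) T≡A++A++Q′yx
  ... | Y₁ , Y≡₁ | Y₂ , Y≡₂ =
    repeated-intro Y₁ A Y₂ (F≢[] (3 + k))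
      (extendʳ [] A T≡A++C++A Y≡₁) (extendʳ A A T≡A++A++Q′yx Y≡₂)

  A-not-right-maximal : ∀ {X Y} → X ≡ [] ⊎ X ≡ A → T ≡ X ++ A ++ Y → ¬ RightMaximal T A Y
  A-not-right-maximal X≡ T≡ rightMax with A-followed-by-a X≡ T≡ | rightMax
  ... | _ , refl | inj₁ ()
  ... | _ , refl | inj₂ (_ , _ , refl , unique) = repeated⇒¬unique A++a-repeated unique

  A-net-position : ∀ p q → NetOcc T p q → sub T p q ≡ A → p ≡ length B + 1
  A-net-position p q net sub≡A with netOcc⇒++ net sub≡A
  ... | X , Y , T≡ , p≡ , rightMax with A-occurrence X T≡
  ... | inj₁ X≡[] = ⊥-elim (A-not-right-maximal (inj₁ X≡[]) T≡ rightMax)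
  ... | inj₂ (inj₁ X≡A) = ⊥-elim (A-not-right-maximal (inj₂ X≡A) T≡ rightMax)
  ... | inj₂ (inj₂ refl) = p≡

  yA-unique : Unique T (y ∷ A)
  yA-unique = unique-intro (P ++ [ x ]) [] (λ ()) T≡ only
    where
    T≡ : T ≡ (P ++ [ x ]) ++ (y ∷ A) ++ []
    T≡ = trans T≡B++A (trans (cong (_++ A ++ []) B≡P++x++y) (++-assoc (P ++ [ x ]) [ y ] (A ++ [])))
    only : ∀ X′ Y′ → T ≡ X′ ++ (y ∷ A) ++ Y′ → X′ ≡ P ++ [ x ]
    only X′ Y′ T≡′ with A-occurrence (X′ ++ [ y ]) (trans T≡′ (sym (++-assoc X′ [ y ] (A ++ Y′))))
    ... | inj₁ X′y≡[] = ⊥-elim (∷ʳ≢[] X′ y X′y≡[])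
    ... | inj₂ (inj₁ X′y≡A) = ⊥-elim (x≢y (sym (∷ʳ-injectiveʳ X′ init (trans X′y≡A F≡init++x))))
    ... | inj₂ (inj₂ X′y≡B) = ∷ʳ-injectiveˡ X′ (P ++ [ x ]) (trans X′y≡B B≡P++x++y)

  A-net-at-B : NetOcc T (length B + 1) (length B + length A)
             × sub T (length B + 1) (length B + length A) ≡ A
  A-net-at-B =
    netOcc-intro B A [] T≡B++A (F≢[] (3 + k))
      (repeated-intro (C ++ A) B [] (F≢[] (4 + k)) T≡A++C++A T≡B++A)
      (inj₂ (P ++ [ x ] , y , B≡P++x++y , yA-unique)) (inj₁ refl) ,
    ++⇒sub B A [] T≡B++A refl refl

  P-occurrence : ∀ X {Y} → T ≡ X ++ P ++ Y → X ≡ [] ⊎ X ≡ A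
  P-occurrence X {Y} T≡ with A-occurrence X (trans T≡ (cong (X ++_) (++-assoc A Q′ Y)))
  ... | inj₁ X≡[] = inj₁ X≡[]
  ... | inj₂ (inj₁ X≡A) = inj₂ X≡A
  ... | inj₂ (inj₂ refl) =
    ⊥-elim (Q′≢[] (++-conicalˡ Q′ Y
      (++-identityʳ-unique A (trans (++-cancelˡ B _ _ T≡) (++-assoc A Q′ Y)))))

  P-net-positions : ∀ p q → NetOcc T p q → sub T p q ≡ P → p ≡ 1 ⊎ p ≡ length A + 1
  P-net-positions p q net sub≡P with netOcc⇒++ net sub≡P
  ... | X , _ , T≡ , p≡ , _ with P-occurrence X T≡
  ... | inj₁ refl = inj₁ p≡
  ... | inj₂ refl = inj₂ p≡

  P∷ʳ-occurrence : ∀ X {l Y} → T ≡ X ++ (P ++ [ l ]) ++ Y → (X ≡ [] × l ≡ x) ⊎ (X ≡ A × l ≡ y)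
  P∷ʳ-occurrence X T≡ with P-occurrence X (shrinkʳ X P T≡)
  ... | inj₁ refl =
    inj₁ (refl , ∷-injectiveˡ (++-cancelˡ P _ _ (trans (sym (shrinkʳ [] P T≡)) T≡P++xyA)))
  ... | inj₂ refl =
    inj₂ (refl , ∷-injectiveˡ (++-cancelˡ P _ _
                   (++-cancelˡ A _ _ (trans (sym (shrinkʳ A P T≡)) T≡A++P++yx))))

  P-repeated : Repeated T P
  P-repeated = repeated-intro (x ∷ y ∷ A) A (y ∷ x ∷ []) (F≢[] (3 + k)) T≡P++xyA T≡A++P++yx

  P≢[] : P ≢ []
  P≢[] = F≢[] (3 + k) ∘ ++-conicalˡ A Q′

  P-net-at-start : NetOcc T 1 (length P) × sub T 1 (length P) ≡ P
  P-net-at-start =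
    netOcc-intro [] P (x ∷ y ∷ A) T≡P++xyA P≢[] P-repeated
      (inj₁ refl) (inj₂ (x , y ∷ A , refl , Px-unique)) ,
    ++⇒sub [] P _ T≡P++xyA refl refl
    where
    Px-unique : Unique T (P ++ [ x ])
    Px-unique = unique-intro [] (y ∷ A) (∷ʳ≢[] P x) (extendʳ [] P T≡P++xyA refl)
      λ X′ _ → Sum.[ proj₁ , ⊥-elim ∘ x≢y ∘ proj₂ ] ∘ P∷ʳ-occurrence X′

  P-net-after-A : NetOcc T (length A + 1) (length A + length P)
                × sub T (length A + 1) (length A + length P) ≡ P
  P-net-after-A =
    netOcc-intro A P (y ∷ x ∷ []) T≡A++P++yx P≢[] P-repeated
      (inj₂ (init , x , F≡init++x , xP-unique)) (inj₂ (y , x ∷ [] , refl , Py-unique)) ,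
    ++⇒sub A P _ T≡A++P++yx refl refl
    where
    xP-unique : Unique T (x ∷ P)
    xP-unique = unique-intro init (y ∷ x ∷ []) (λ ()) T≡ only
      where
      T≡ : T ≡ init ++ (x ∷ P) ++ y ∷ x ∷ []
      T≡ = trans T≡A++P++yx (trans (cong (_++ P ++ y ∷ x ∷ []) F≡init++x) (++-assoc init [ x ] _))
      only : ∀ X′ Y′ → T ≡ X′ ++ (x ∷ P) ++ Y′ → X′ ≡ init
      only X′ Y′ T≡′ with P-occurrence (X′ ++ [ x ]) (trans T≡′ (sym (++-assoc X′ [ x ] (P ++ Y′))))
      ... | inj₁ X′x≡[] = ⊥-elim (∷ʳ≢[] X′ x X′x≡[])
      ... | inj₂ X′x≡A = ∷ʳ-injectiveˡ X′ init (trans X′x≡A F≡init++x)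
    Py-unique : Unique T (P ++ [ y ])
    Py-unique = unique-intro A (x ∷ []) (∷ʳ≢[] P y) (extendʳ A P T≡A++P++yx refl)
      λ X′ _ → Sum.[ ⊥-elim ∘ x≢y ∘ sym ∘ proj₂ , proj₁ ] ∘ P∷ʳ-occurrence X′

lemma25 : (i : ℕ) → 7 ≤ i →
    ((p q : ℕ) → NetOcc (F i) p q → sub (F i) p q ≡ F (i ∸ 2) → p ≡ f (i ∸ 1) + 1)
    × (NetOcc (F i) (f (i ∸ 1) + 1) (f (i ∸ 1) + f (i ∸ 2))
       × sub (F i) (f (i ∸ 1) + 1) (f (i ∸ 1) + f (i ∸ 2)) ≡ F (i ∸ 2))
    × ((p q : ℕ) → NetOcc (F i) p q → sub (F i) p q ≡ F (i ∸ 2) ++ Q i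
         → (p ≡ 1) ⊎ (p ≡ f (i ∸ 2) + 1))
    × (NetOcc (F i) 1 (length (F (i ∸ 2) ++ Q i))
       × sub (F i) 1 (length (F (i ∸ 2) ++ Q i)) ≡ F (i ∸ 2) ++ Q i)
    × (NetOcc (F i) (f (i ∸ 2) + 1) (f (i ∸ 2) + length (F (i ∸ 2) ++ Q i))
       × sub (F i) (f (i ∸ 2) + 1) (f (i ∸ 2) + length (F (i ∸ 2) ++ Q i)) ≡ F (i ∸ 2) ++ Q i)
lemma25 (suc (suc (suc (suc (suc (suc (suc k))))))) (s≤s (s≤s (s≤s (s≤s (s≤s (s≤s (s≤s z≤n))))))) =
  A-net-position , A-net-at-B , P-net-positions , P-net-at-start , P-net-after-A
  where open NetOccurrences k
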